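{- If $G$ is a cograph whose normalized cotree has $r$ bags (i.e. has bag representation $\{B_i^{t_i}\}_{i=1}^r$), then $G$ has at most $r$ main $\mathbf{Q}$-eigenvalues.
   Context: All graphs are finite and simple. A cograph is a $P_4$-free graph; it is represented by a rooted tree (cotree) whose leaves are the vertices and whose internal nodes are labeled $\cup$ (disjoint union) or $\oplus$ (join), two vertices being adjacent iff their lowest common ancestor is labeled $\oplus$. The cotree is normalized if every internal node has at least two children and a label different from its parent's. A bag is the set of all leaf children of an internal node; the bag representation $\{B_i^{t_i}\}_{i=1}^r$ lists the $r$ bags $B_i$ with $t_i=|B_i|$, and $r$ is the width of the cotree. $\mathbf{Q}(G)=\mathbf{D}(G)+\mathbf{A}(G)$ is the signless Laplacian matrix; an eigenvalue of $\mathbf{Q}(G)$ is main if its eigenspace is not orthogonal to the all-ones vector, and the number of main $\mathbf{Q}$-eigenvalues counts distinct such eigenvalues. -}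

module Defs where

import Level
open import Level using (Level; _⊔_) renaming (suc to lsuc)
open import Data.Nat using (ℕ; zero; suc; _≤_) renaming (_+_ to _+ℕ_)
open import Data.Bool using (Bool; true; false; if_then_else_; _∨_)
open import Data.Fin using (Fin; splitAt; _≟_)
import Data.Fin as Fin
open import Data.Sum using (_⊎_; inj₁; inj₂)
open import Data.List using (List; []; _∷_; length)
open import Data.Maybe using (Maybe; just; nothing)
open import Data.Product using (Σ; _×_; ∃)
open import Data.Unit using (⊤)
open import Data.Empty using (⊥)
open import Relation.Nullary using (¬_; does)
open import Relation.Binary.PropositionalEquality using (_≡_)
open import Algebra.Bundles using (CommutativeRing)

data Label : Set where
  ∪ⁿ : Label
  ⊕ⁿ : Label

isJoin : Label → Bool
isJoin ∪ⁿ = false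
isJoin ⊕ⁿ = true

data Cotree : Set where
  leaf : Cotree
  node : Label → List Cotree → Cotree

isLeaf : Cotree → Bool
isLeaf leaf = true
isLeaf (node _ _) = false

mutual
  size : Cotree → ℕ
  size leaf = 1
  size (node _ ts) = sizes ts

  sizes : List Cotree → ℕ
  sizes [] = 0
  sizes (t ∷ ts) = size t +ℕ sizes ts

-- The cograph represented by a cotree: the vertices are the leaves,
-- enumerated left to right as Fin (size T); two vertices are adjacent
-- iff their lowest common ancestor is labelled ⊕.
mutual
  adj : (T : Cotree) → Fin (size T) → Fin (size T) → Bool
  adj leaf _ _ = false
  adj (node l ts) i j = adjs l ts i j

  adjs : Label → (ts : List Cotree) → Fin (sizes ts) → Fin (sizes ts) → Bool
  adjs l [] i j = false
  adjs l (t ∷ ts) i j = go (splitAt (size t) i) (splitAt (size t) j)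
    where
    go : Fin (size t) ⊎ Fin (sizes ts) → Fin (size t) ⊎ Fin (sizes ts) → Bool
    go (inj₁ a) (inj₁ b) = adj t a b
    go (inj₂ a) (inj₂ b) = adjs l ts a b
    go (inj₁ _) (inj₂ _) = isJoin l           -- LCA is this node
    go (inj₂ _) (inj₁ _) = isJoin l

differs : Maybe Label → Label → Set
differs nothing _ = ⊤
differs (just ∪ⁿ) ∪ⁿ = ⊥
differs (just ∪ⁿ) ⊕ⁿ = ⊤
differs (just ⊕ⁿ) ∪ⁿ = ⊤
differs (just ⊕ⁿ) ⊕ⁿ = ⊥

mutual
  NormalUnder : Maybe Label → Cotree → Set
  NormalUnder p leaf = ⊤
  NormalUnder p (node l ts) = differs p l × (2 ≤ length ts) × AllNormal l ts

  AllNormal : Label → List Cotree → Set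
  AllNormal l [] = ⊤
  AllNormal l (t ∷ ts) = NormalUnder (just l) t × AllNormal l ts

Normalized : Cotree → Set
Normalized = NormalUnder nothing

-- Width: the number of bags, i.e. of internal nodes whose set of leaf
-- children is nonempty.
mutual
  width : Cotree → ℕ
  width leaf = 0
  width (node _ ts) = (if anyLeaf ts then 1 else 0) +ℕ widths ts

  widths : List Cotree → ℕ
  widths [] = 0
  widths (t ∷ ts) = width t +ℕ widths ts

  anyLeaf : List Cotree → Bool
  anyLeaf [] = false
  anyLeaf (t ∷ ts) = isLeaf t ∨ anyLeaf ts

record Field (c ℓ : Level) : Set (lsuc (c ⊔ ℓ)) where
  field
    commRing : CommutativeRing c ℓ
  open CommutativeRing commRing public
  field
    1≉0 : ¬ (1# ≈ 0#)
    inverse : ∀ x → ¬ (x ≈ 0#) → Σ Carrier λ y → x * y ≈ 1#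

module FieldOps {c ℓ} (F : Field c ℓ) where
  open Field F

  ι : ℕ → Carrier
  ι zero = 0#
  ι (suc n) = 1# + ι n

  CharZero : Set ℓ
  CharZero = ∀ n → ι (suc n) ≈ 0# → ⊥

  Σᶠ : ∀ {n} → (Fin n → Carrier) → Carrier
  Σᶠ {zero} f = 0#
  Σᶠ {suc n} f = f Fin.zero + Σᶠ (λ i → f (Fin.suc i))

  b2F : Bool → Carrier
  b2F true = 1#
  b2F false = 0#

  degree : (T : Cotree) → Fin (size T) → ℕ
  degree T i = cnt (λ j → adj T i j)
    where
    cnt : ∀ {n} → (Fin n → Bool) → ℕ
    cnt {zero} f = 0
    cnt {suc n} f = (if f Fin.zero then 1 else 0) +ℕ cnt (λ k → f (Fin.suc k))

  Q : (T : Cotree) → Fin (size T) → Fin (size T) → Carrier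
  Q T i j = (if does (i ≟ j) then ι (degree T i) else 0#) + b2F (adj T i j)

  IsMainQEigenvalue : (T : Cotree) → Carrier → Set (c ⊔ ℓ)
  IsMainQEigenvalue T λ′ = Σ (Fin (size T) → Carrier) λ x →
    (∀ i → Σᶠ (λ j → Q T i j * x j) ≈ λ′ * x i) × ¬ (Σᶠ x ≈ 0#)

  mutual
    Distinct : List Carrier → Set ℓ
    Distinct [] = Level.Lift ℓ ⊤
    Distinct (a ∷ as) = DiffAll a as × Distinct as

    DiffAll : Carrier → List Carrier → Set ℓ
    DiffAll a [] = Level.Lift ℓ ⊤
    DiffAll a (b ∷ bs) = ¬ (a ≈ b) × DiffAll a bs

{-# OPTIONS --safe #-}
module Submission where

-- A vector is balanced if its entries sum to zero over every bag.  As the bags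
-- partition the vertices, balanced vectors are orthogonal to the all-ones
-- vector, and they contain the kernel of the linear map sending a vector to
-- its r bag sums.  They also form a Q-invariant subspace: for balanced z every
-- internal subtree has entry sum zero, so on a leaf u the neighbours of u
-- contribute -z_u or 0 (as u's parent is a join or not) and Qz restricted to a
-- bag is a multiple of z there.  If a combination Σ a_k x_k of eigenvectors
-- for distinct main eigenvalues μ_k is balanced, applying Q - μ₀ and induction
-- give a_k = 0 for k > 0, and summing the entries of a₀ x₀ gives a₀ = 0.  So
-- the bag-sum images of the x_k are linearly independent in F^r.

open import Defs
open import Level using (0ℓ; _⊔_; Lift; lift)
open import Function using (_∘_)
open import Data.Unit using (⊤; tt)
open import Data.Empty using (⊥-elim)
open import Data.Bool using (Bool; true; false; if_then_else_)
open import Data.Nat as ℕ using (ℕ; zero; suc; _∸_; _≤_; z≤n; s≤s; _≤?_)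
open import Data.Fin using (Fin; zero; suc; punchIn; punchOut; _≟_; _↑ˡ_; _↑ʳ_; splitAt)
open import Data.Fin.Properties using (punchIn-punchOut; splitAt-↑ˡ; splitAt-↑ʳ)
open import Data.Sum using (inj₁; inj₂)
open import Data.Product using (Σ; _×_; _,_; proj₁; proj₂)
open import Data.Product.Properties using (≡-dec)
open import Data.Maybe using (Maybe; map)
open import Data.List as List using (List; []; _∷_; length)
open import Data.List.Relation.Unary.All as All using (All; _∷_)
open import Data.Vec.Functional as Vector using (Vector; take; drop)
open import Data.Vec.Functional.Properties using (lookup-++ˡ; lookup-++ʳ)
open import Relation.Nullary using (¬_; yes; no; does)
open import Relation.Nullary.Decidable using (decidable-stable)
open import Relation.Binary.Consequences using (dec⇒weaklyDec)
import Relation.Binary.PropositionalEquality as ≡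
open import Algebra.Bundles using (CommutativeRing)
open import Algebra.Bundles.Raw using (RawRing)

-- The library's solvers for an arbitrary commutative ring take coefficients in
-- the ring itself and so cannot cancel x - x; with integer coefficients every
-- commutative-ring identity is provable.
module IntegerCoefficientRingSolver {c ℓ} (R : CommutativeRing c ℓ) where
  open CommutativeRing R
  open import Algebra.Properties.Ring ring
    using (-‿+-comm; ⁻¹-anti-homo‿-; -‿distribˡ-*; -‿distribʳ-*; -‿involutive; -0#≈0#)
  open import Algebra.Properties.Semiring.Mult semiring using (×-homo-+; ×1-homo-*)
    renaming (_×_ to _·_)
  open import Algebra.Solver.Ring.AlmostCommutativeRing
    using (fromCommutativeRing; _-Raw-AlmostCommutative⟶_)
  import Algebra.Solver.Ring.NaturalCoefficients.Default commutativeSemiring as ℕ-Solver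
  open import Relation.Binary.Reasoning.Setoid setoid

  private
    open ℕ-Solver using (_:+_; _:*_; _:=_)

    normalise : ℕ × ℕ → ℕ × ℕ
    normalise (m , n) = m ∸ n , n ∸ m

    -- The pair (m , n) represents the integer m - n.  The operations keep
    -- one component zero, so that equal integers get equal representatives.
    ℤ² : RawRing 0ℓ 0ℓ
    ℤ² = record
      { Carrier = ℕ × ℕ
      ; _≈_ = ≡._≡_
      ; _+_ = λ { (a , b) (c , d) → normalise (a ℕ.+ c , b ℕ.+ d) }
      ; _*_ = λ { (a , b) (c , d) → normalise (a ℕ.* c ℕ.+ b ℕ.* d , a ℕ.* d ℕ.+ b ℕ.* c) }
      ; -_ = λ { (a , b) → b , a }
      ; 0# = 0 , 0
      ; 1# = 1 , 0
      }

    ⟦_⟧ : ℕ × ℕ → Carrier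
    ⟦ m , n ⟧ = m · 1# - n · 1#

    ⟦normalise⟧ : ∀ m n → ⟦ normalise (m , n) ⟧ ≈ ⟦ m , n ⟧
    ⟦normalise⟧ zero    zero    = refl
    ⟦normalise⟧ zero    (suc n) = refl
    ⟦normalise⟧ (suc m) zero    = refl
    ⟦normalise⟧ (suc m) (suc n) = begin
      ⟦ normalise (m , n) ⟧     ≈⟨ ⟦normalise⟧ m n ⟩
      x - y                     ≈⟨ +-identityʳ (x - y) ⟨
      x - y + 0#                ≈⟨ +-congˡ (-‿inverseʳ 1#) ⟨
      x - y + (1# - 1#)         ≈⟨ ℕ-Solver.solve 4 (λ x y u v → (x :+ y) :+ (u :+ v) := (u :+ x) :+ (v :+ y))
                                                     refl x (- y) 1# (- 1#) ⟩
      (1# + x) + (- 1# + - y)   ≈⟨ +-congˡ (-‿+-comm 1# y) ⟩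
      (1# + x) - (1# + y)       ∎
      where
      x = m · 1#
      y = n · 1#

    +-homo : ∀ a b c d → ⟦ normalise (a ℕ.+ c , b ℕ.+ d) ⟧ ≈ ⟦ a , b ⟧ + ⟦ c , d ⟧
    +-homo a b c d = begin
      ⟦ normalise (a ℕ.+ c , b ℕ.+ d) ⟧   ≈⟨ ⟦normalise⟧ (a ℕ.+ c) (b ℕ.+ d) ⟩
      (a ℕ.+ c) · 1# - (b ℕ.+ d) · 1#     ≈⟨ +-cong (×-homo-+ 1# a c) (-‿cong (×-homo-+ 1# b d)) ⟩
      (x + z) - (y + w)                   ≈⟨ +-congˡ (-‿+-comm y w) ⟨
      (x + z) + (- y + - w)               ≈⟨ ℕ-Solver.solve 4 (λ x z y w → (x :+ z) :+ (y :+ w) := (x :+ y) :+ (z :+ w))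
                                                               refl x z (- y) (- w) ⟩
      (x - y) + (z - w)                   ∎
      where
      x = a · 1#
      y = b · 1#
      z = c · 1#
      w = d · 1#

    *-homo : ∀ a b c d →
      ⟦ normalise (a ℕ.* c ℕ.+ b ℕ.* d , a ℕ.* d ℕ.+ b ℕ.* c) ⟧ ≈ ⟦ a , b ⟧ * ⟦ c , d ⟧
    *-homo a b c d = begin
      ⟦ normalise (a ℕ.* c ℕ.+ b ℕ.* d , a ℕ.* d ℕ.+ b ℕ.* c) ⟧
        ≈⟨ ⟦normalise⟧ (a ℕ.* c ℕ.+ b ℕ.* d) (a ℕ.* d ℕ.+ b ℕ.* c) ⟩
      (a ℕ.* c ℕ.+ b ℕ.* d) · 1# - (a ℕ.* d ℕ.+ b ℕ.* c) · 1#
        ≈⟨ +-cong (embed a c b d) (-‿cong (embed a d b c)) ⟩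
      (x * z + y * w) - (x * w + y * z)
        ≈⟨ +-cong (+-congˡ (-y*-w≈y*w)) (-‿+-comm (x * w) (y * z)) ⟨
      (x * z + - y * - w) + (- (x * w) + - (y * z))
        ≈⟨ +-congˡ (+-cong (-‿distribʳ-* x w) (-‿distribˡ-* y z)) ⟩
      (x * z + - y * - w) + (x * - w + - y * z)
        ≈⟨ ℕ-Solver.solve 4 (λ x y z w → (x :* z :+ y :* w) :+ (x :* w :+ y :* z) := (x :+ y) :* (z :+ w))
                            refl x (- y) z (- w) ⟩
      (x - y) * (z - w) ∎
      where
      x = a · 1#
      y = b · 1#
      z = c · 1#
      w = d · 1#
      embed : ∀ p q r s → (p ℕ.* q ℕ.+ r ℕ.* s) · 1# ≈ p · 1# * q · 1# + r · 1# * s · 1#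
      embed p q r s = trans (×-homo-+ 1# (p ℕ.* q) (r ℕ.* s)) (+-cong (×1-homo-* p q) (×1-homo-* r s))
      -y*-w≈y*w : - y * - w ≈ y * w
      -y*-w≈y*w = begin
        - y * - w       ≈⟨ -‿distribˡ-* y (- w) ⟨
        - (y * - w)     ≈⟨ -‿cong (-‿distribʳ-* y w) ⟨
        - - (y * w)     ≈⟨ -‿involutive (y * w) ⟩
        y * w           ∎

    morphism : ℤ² -Raw-AlmostCommutative⟶ fromCommutativeRing R
    morphism = record
      { ⟦_⟧ = ⟦_⟧
      ; +-homo = λ { (a , b) (c , d) → +-homo a b c d }
      ; *-homo = λ { (a , b) (c , d) → *-homo a b c d }
      ; -‿homo = λ { (a , b) → sym (⁻¹-anti-homo‿- (a · 1#) (b · 1#)) }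
      ; 0-homo = -‿inverseʳ 0#
      ; 1-homo = trans (+-cong (+-identityʳ 1#) -0#≈0#) (+-identityʳ 1#)
      }

    ≡⇒⟦≈⟧ : ∀ {p q} → p ≡.≡ q → ⟦ p ⟧ ≈ ⟦ q ⟧
    ≡⇒⟦≈⟧ ≡.refl = refl

    _≟ᶜ_ : ∀ p q → Maybe (⟦ p ⟧ ≈ ⟦ q ⟧)
    p ≟ᶜ q = map ≡⇒⟦≈⟧ (dec⇒weaklyDec (≡-dec ℕ._≟_ ℕ._≟_) p q)

  open import Algebra.Solver.Ring ℤ² (fromCommutativeRing R) morphism _≟ᶜ_ public
    using (solve; _:=_; _:+_; _:*_; :-_; _:-_)

¬¬-∀-Fin : ∀ {n p} {P : Fin n → Set p} → (∀ i → ¬ ¬ P i) → ¬ ¬ (∀ i → P i)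
¬¬-∀-Fin {zero}  _   k = k λ ()
¬¬-∀-Fin {suc n} ¬¬P k =
  ¬¬P zero λ P₀ → ¬¬-∀-Fin (¬¬P ∘ suc) λ Pₛ → k λ { zero → P₀ ; (suc i) → Pₛ i }

module LinearAlgebra {c ℓ} (F : Field c ℓ) where
  open Field F hiding (zero)
  open FieldOps F using (ι; Σᶠ; Distinct; DiffAll)
  open IntegerCoefficientRingSolver commRing
  open import Algebra.Properties.Ring ring using (x+x≈x⇒x≈0; x∙y⁻¹≈ε⇒x≈y)
  open import Algebra.Properties.Semiring.Sum semiring
    using (sum; sum-cong-≋; sum-replicate-zero; ∑-distrib-+; *-distribˡ-sum)
  open import Data.Vec.Functional.Relation.Binary.Equality.Setoid setoid
    using (_≋_; ≋-sym; ≋-trans)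
  open import Relation.Binary.Reasoning.Setoid setoid

  private
    variable
      m n r : ℕ

  infixl 7 _·ᵛ_
  infixl 6 _+ᵛ_
  infixr 8 _*ᴹ_

  0ᵛ : Vector Carrier n
  0ᵛ _ = 0#

  _·ᵛ_ : Carrier → Vector Carrier n → Vector Carrier n
  (a ·ᵛ x) i = a * x i

  _+ᵛ_ : Vector Carrier n → Vector Carrier n → Vector Carrier n
  (x +ᵛ y) i = x i + y i

  _*ᴹ_ : (Fin m → Fin n → Carrier) → Vector Carrier n → Vector Carrier m
  (M *ᴹ x) i = sum λ j → M i j * x j

  combination : (Fin m → Carrier) → (Fin m → Vector Carrier n) → Vector Carrier n
  combination a X u = sum λ k → a k * X k u

  IsLinear : (Vector Carrier n → Vector Carrier r) → Set (c ⊔ ℓ)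
  IsLinear f = ∀ a {x y w} → w ≋ a ·ᵛ x +ᵛ y → f w ≋ a ·ᵛ f x +ᵛ f y

  IsSubspace : ∀ {p} → (Vector Carrier n → Set p) → Set (c ⊔ ℓ ⊔ p)
  IsSubspace Z = ∀ a {x y w} → w ≋ a ·ᵛ x +ᵛ y → Z x → Z y → Z w

  LinearlyIndependent : (Fin m → Vector Carrier n) → Set (c ⊔ ℓ)
  LinearlyIndependent X = ∀ a → combination a X ≋ 0ᵛ → ∀ k → a k ≈ 0#

  x*y≈0⇒x≈0 : ∀ {x y} → ¬ y ≈ 0# → x * y ≈ 0# → x ≈ 0#
  x*y≈0⇒x≈0 {x} {y} y≉0 xy≈0 = begin
    x               ≈⟨ *-identityʳ x ⟨
    x * 1#          ≈⟨ *-congˡ y*y⁻¹≈1 ⟨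
    x * (y * y⁻¹)   ≈⟨ *-assoc x y y⁻¹ ⟨
    x * y * y⁻¹     ≈⟨ *-congʳ xy≈0 ⟩
    0# * y⁻¹        ≈⟨ zeroˡ y⁻¹ ⟩
    0#              ∎
    where
    y⁻¹ : Carrier
    y⁻¹ = proj₁ (inverse y y≉0)
    y*y⁻¹≈1 : y * y⁻¹ ≈ 1#
    y*y⁻¹≈1 = proj₂ (inverse y y≉0)

  ≋⇒≋0·+ : {w y : Vector Carrier n} → w ≋ y → w ≋ 0# ·ᵛ y +ᵛ y
  ≋⇒≋0·+ w≋y i = trans (w≋y i) (sym (trans (+-congʳ (zeroˡ _)) (+-identityˡ _)))

  IsSubspace⇒cong : ∀ {p} {Z : Vector Carrier n → Set p} → IsSubspace Z →
                    ∀ {w y} → w ≋ y → Z y → Z w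
  IsSubspace⇒cong Z-subspace w≋y Zy = Z-subspace 0# (≋⇒≋0·+ w≋y) Zy Zy

  sum-0ᵛ : {x : Vector Carrier n} → x ≋ 0ᵛ → sum x ≈ 0#
  sum-0ᵛ {n} x≋0 = trans (sum-cong-≋ x≋0) (sum-replicate-zero n)

  sum-axpy : ∀ a (x y : Vector Carrier n) → sum (a ·ᵛ x +ᵛ y) ≈ a * sum x + sum y
  sum-axpy a x y = trans (∑-distrib-+ (a ·ᵛ x) y) (+-congʳ (sym (*-distribˡ-sum a x)))

  ι-+ : ∀ m n → ι (m ℕ.+ n) ≈ ι m + ι n
  ι-+ zero    n = sym (+-identityˡ _)
  ι-+ (suc m) n = trans (+-congˡ (ι-+ m n)) (sym (+-assoc _ _ _))

  sum-const : ∀ n x → sum {n} (λ _ → x) ≈ ι n * x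
  sum-const zero    x = sym (zeroˡ x)
  sum-const (suc n) x = trans (+-cong (sym (*-identityˡ x)) (sum-const n x)) (sym (distribʳ x 1# (ι n)))

  sum-split : ∀ m {n} (z : Vector Carrier (m ℕ.+ n)) → sum z ≈ sum (take m z) + sum (drop m z)
  sum-split zero    z = sym (+-identityˡ _)
  sum-split (suc m) z = trans (+-congˡ (sum-split m (z ∘ suc))) (sym (+-assoc _ _ _))

  Σᶠ≡sum : (f : Vector Carrier n) → Σᶠ f ≡.≡ sum f
  Σᶠ≡sum {zero}  f = ≡.refl
  Σᶠ≡sum {suc n} f = ≡.cong (f zero +_) (Σᶠ≡sum (f ∘ suc))

  δ-sum : (i : Fin n) (d : Carrier) (x : Vector Carrier n) →
          sum (λ j → (if does (i ≟ j) then d else 0#) * x j) ≈ d * x i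
  δ-sum zero    d x = trans (+-congˡ (sum-0ᵛ λ j → zeroˡ (x (suc j)))) (+-identityʳ _)
  δ-sum (suc i) d x = trans (+-cong (zeroˡ _) (δ-sum i d (x ∘ suc))) (+-identityˡ _)

  IsLinear-*ᴹ : (M : Fin m → Fin n → Carrier) → IsLinear (M *ᴹ_)
  IsLinear-*ᴹ M a {x} {y} {w} w≋ax+y i = begin
    sum (λ j → M i j * w j)
      ≈⟨ sum-cong-≋ (λ j → *-congˡ (w≋ax+y j)) ⟩
    sum (λ j → M i j * (a * x j + y j))
      ≈⟨ sum-cong-≋ (λ j → solve 4 (λ m a x y → m :* (a :* x :+ y) := a :* (m :* x) :+ m :* y)
                                   refl (M i j) a (x j) (y j)) ⟩
    sum (a ·ᵛ (λ j → M i j * x j) +ᵛ (λ j → M i j * y j))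
      ≈⟨ sum-axpy a (λ j → M i j * x j) (λ j → M i j * y j) ⟩
    a * (M *ᴹ x) i + (M *ᴹ y) i ∎

  IsLinear-zero : ∀ {f : Vector Carrier n → Vector Carrier r} → IsLinear f → f 0ᵛ ≋ 0ᵛ
  IsLinear-zero {f = f} f-linear i = x+x≈x⇒x≈0 (f 0ᵛ i)
    (trans (+-congʳ (sym (*-identityˡ _))) (sym (f-linear 1# 0≈1*0+0 i)))
    where
    0≈1*0+0 : 0ᵛ ≋ 1# ·ᵛ 0ᵛ +ᵛ 0ᵛ
    0≈1*0+0 _ = sym (trans (+-identityʳ _) (*-identityˡ _))

  IsLinear-combination : ∀ {f : Vector Carrier n → Vector Carrier r} → IsLinear f →
    (a : Fin m → Carrier) (X : Fin m → Vector Carrier n) → f (combination a X) ≋ combination a (f ∘ X)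
  IsLinear-combination {m = zero}  f-linear a X = IsLinear-zero f-linear
  IsLinear-combination {m = suc m} f-linear a X i =
    trans (f-linear (a zero) (λ _ → refl) i)
          (+-congˡ (IsLinear-combination f-linear (a ∘ suc) (X ∘ suc) i))

  combination-zero : (a : Fin m → Carrier) (X : Fin m → Vector Carrier n) →
                     (∀ k → a k ≈ 0#) → combination a X ≋ 0ᵛ
  combination-zero {m} a X a≈0 u = sum-0ᵛ λ k → trans (*-congʳ (a≈0 k)) (zeroˡ _)

  combination-axpy : (a b : Fin m → Carrier) (y : Vector Carrier n) (X : Fin m → Vector Carrier n) →
    combination a (λ k → b k ·ᵛ y +ᵛ X k) ≋ sum (λ k → a k * b k) ·ᵛ y +ᵛ combination a X
  combination-axpy a b y X u = begin
    sum (λ k → a k * (b k * y u + X k u))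
      ≈⟨ sum-cong-≋ (λ k → solve 4 (λ a b y x → a :* (b :* y :+ x) := y :* (a :* b) :+ a :* x)
                                   refl (a k) (b k) (y u) (X k u)) ⟩
    sum (y u ·ᵛ (λ k → a k * b k) +ᵛ (λ k → a k * X k u))
      ≈⟨ sum-axpy (y u) (λ k → a k * b k) (λ k → a k * X k u) ⟩
    y u * sum (λ k → a k * b k) + combination a X u
      ≈⟨ +-congʳ (*-comm _ _) ⟩
    sum (λ k → a k * b k) * y u + combination a X u ∎

  combination-shift : ∀ μ (λs a : Fin m → Carrier) (X : Fin m → Vector Carrier n) →
    combination (λ k → a k * (λs k - μ)) X ≋ - μ ·ᵛ combination a X +ᵛ combination a (λ k → λs k ·ᵛ X k)
  combination-shift μ λs a X u = begin
    sum (λ k → a k * (λs k - μ) * X k u)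
      ≈⟨ sum-cong-≋ (λ k → solve 4 (λ μ l a x → a :* (l :- μ) :* x := :- μ :* (a :* x) :+ a :* (l :* x))
                                   refl μ (λs k) (a k) (X k u)) ⟩
    sum (- μ ·ᵛ (λ k → a k * X k u) +ᵛ (λ k → a k * (λs k * X k u)))
      ≈⟨ sum-axpy (- μ) (λ k → a k * X k u) (λ k → a k * (λs k * X k u)) ⟩
    - μ * combination a X u + combination a (λ k → λs k ·ᵛ X k) u ∎

  module Elimination {m n} (X : Fin (suc m) → Vector Carrier (suc n))
                     (p : Fin (suc n)) (X₀ₚ≉0 : ¬ X zero p ≈ 0#) where

    private
      q : Carrier
      q = proj₁ (inverse _ X₀ₚ≉0)
      X₀ₚ*q≈1 : X zero p * q ≈ 1#
      X₀ₚ*q≈1 = proj₂ (inverse _ X₀ₚ≉0)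

    cleared : Fin m → Vector Carrier (suc n)
    cleared k = - (X (suc k) p * q) ·ᵛ X zero +ᵛ X (suc k)

    cleared-pivot : ∀ k → cleared k p ≈ 0#
    cleared-pivot k = begin
      - (x * q) * X zero p + x   ≈⟨ solve 3 (λ x q y → :- (x :* q) :* y :+ x := x :- x :* (y :* q))
                                            refl x q (X zero p) ⟩
      x - x * (X zero p * q)     ≈⟨ +-congˡ (-‿cong (trans (*-congˡ X₀ₚ*q≈1) (*-identityʳ x))) ⟩
      x - x                      ≈⟨ -‿inverseʳ x ⟩
      0#                         ∎
      where x = X (suc k) p

    reduced : Fin m → Vector Carrier n
    reduced k = cleared k ∘ punchIn p

    reduced-independent : LinearlyIndependent X → LinearlyIndependent reduced
    reduced-independent X-independent a a·reduced≈0 k =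
      X-independent (a₀ Vector.∷ a)
        (≋-trans (≋-sym (combination-axpy a b (X zero) (X ∘ suc))) a·cleared≈0) (suc k)
      where
      b : Fin m → Carrier
      b k = - (X (suc k) p * q)
      a₀ : Carrier
      a₀ = sum λ k → a k * b k
      a·cleared≈0 : combination a cleared ≋ 0ᵛ
      a·cleared≈0 j with p ≟ j
      ... | yes ≡.refl = sum-0ᵛ λ k → trans (*-congˡ (cleared-pivot k)) (zeroʳ _)
      ... | no p≢j = ≡.subst (λ j → combination a cleared j ≈ 0#) (punchIn-punchOut p≢j)
                             (a·reduced≈0 (punchOut p≢j))

  unit-relation : (X : Fin (suc m) → Vector Carrier n) → X zero ≋ 0ᵛ →
                  combination (1# Vector.∷ 0ᵛ) X ≋ 0ᵛ
  unit-relation X X₀≈0 u = trans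
    (+-cong (trans (*-identityˡ _) (X₀≈0 u)) (combination-zero 0ᵛ (X ∘ suc) (λ _ → refl) u))
    (+-identityˡ 0#)

  -- Gaussian elimination.  Whether an entry vanishes is undecidable, so the
  -- pivot is only found under a double negation; m ≤ n is decidable.
  independent⇒≤ : (X : Fin m → Vector Carrier n) → LinearlyIndependent X → m ≤ n
  independent⇒≤ {zero} X _ = z≤n
  independent⇒≤ {suc m} {zero} X X-independent =
    ⊥-elim (1≉0 (X-independent (1# Vector.∷ 0ᵛ) (λ ()) zero))
  independent⇒≤ {suc m} {suc n} X X-independent = decidable-stable (suc m ≤? suc n) λ m≰n →
    ¬¬-∀-Fin (λ p X₀ₚ≉0 → let open Elimination X p X₀ₚ≉0 in
                 m≰n (s≤s (independent⇒≤ reduced (reduced-independent X-independent))))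
             (λ X₀≈0 → 1≉0 (X-independent (1# Vector.∷ 0ᵛ) (unit-relation X X₀≈0) zero))

  IsMainEigenvalue : (Fin n → Fin n → Carrier) → Carrier → Set (c ⊔ ℓ)
  IsMainEigenvalue M μ = Σ (Vector Carrier _) λ x → M *ᴹ x ≋ μ ·ᵛ x × ¬ sum x ≈ 0#

  module _ {n} {M : Fin n → Fin n → Carrier} where

    eigenvectors : ∀ {μs} → All (IsMainEigenvalue M) μs → Fin (length μs) → Vector Carrier n
    eigenvectors (p ∷ _)  zero    = proj₁ p
    eigenvectors (_ ∷ ps) (suc k) = eigenvectors ps k

    eigenvectors-eigen : ∀ {μs} (ps : All (IsMainEigenvalue M) μs) k →
                         M *ᴹ eigenvectors ps k ≋ List.lookup μs k ·ᵛ eigenvectors ps k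
    eigenvectors-eigen (p ∷ _)  zero    = proj₁ (proj₂ p)
    eigenvectors-eigen (_ ∷ ps) (suc k) = eigenvectors-eigen ps k

  DiffAll-lookup : ∀ {μ} μs → DiffAll μ μs → ∀ k → ¬ List.lookup μs k - μ ≈ 0#
  DiffAll-lookup (_ ∷ _)  (μ≉ν , _) zero    ν-μ≈0 = μ≉ν (sym (x∙y⁻¹≈ε⇒x≈y _ _ ν-μ≈0))
  DiffAll-lookup (_ ∷ μs) (_ , μ∉)  (suc k) = DiffAll-lookup μs μ∉ k

  module InvariantSubspace {n p} (M : Fin n → Fin n → Carrier) (Z : Vector Carrier n → Set p)
    (Z-subspace : IsSubspace Z) (Z-invariant : ∀ {x} → Z x → Z (M *ᴹ x))
    (Z⊥𝟙 : ∀ {x} → Z x → sum x ≈ 0#) where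

    main-eigenvectors-independent-modulo-Z : ∀ {μs} → Distinct μs → (ps : All (IsMainEigenvalue M) μs) →
      ∀ a → Z (combination a (eigenvectors ps)) → ∀ k → a k ≈ 0#
    main-eigenvectors-independent-modulo-Z {μ ∷ μs} (μ∉μs , μs-distinct) (p@(x , _ , Σx≉0) ∷ ps) a Zw =
      λ { zero → a₀≈0 ; (suc k) → aₛ≈0 k }
      where
      X : Fin (length (μ ∷ μs)) → Vector Carrier n
      X = eigenvectors (p ∷ ps)
      w : Vector Carrier n
      w = combination a X
      b : Fin (length μs) → Carrier
      b k = a (suc k) * (List.lookup μs k - μ)
      b·X′≈[M-μ]w : combination b (eigenvectors ps) ≋ - μ ·ᵛ w +ᵛ M *ᴹ w
      b·X′≈[M-μ]w u = begin
        combination b (eigenvectors ps) u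
          ≈⟨ +-identityˡ _ ⟨
        0# + combination b (eigenvectors ps) u
          ≈⟨ +-congʳ a₀[μ-μ]x≈0 ⟨
        combination (λ k → a k * (List.lookup (μ ∷ μs) k - μ)) X u
          ≈⟨ combination-shift μ (List.lookup (μ ∷ μs)) a X u ⟩
        - μ * w u + combination a (λ k → List.lookup (μ ∷ μs) k ·ᵛ X k) u
          ≈⟨ +-congˡ (sum-cong-≋ λ k → *-congˡ {a k} (eigenvectors-eigen (p ∷ ps) k u)) ⟨
        - μ * w u + combination a (λ k → M *ᴹ X k) u
          ≈⟨ +-congˡ (IsLinear-combination (IsLinear-*ᴹ M) a X u) ⟨
        - μ * w u + (M *ᴹ w) u ∎
        where
        a₀[μ-μ]x≈0 : a zero * (μ - μ) * x u ≈ 0#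
        a₀[μ-μ]x≈0 = trans (*-congʳ (trans (*-congˡ (-‿inverseʳ μ)) (zeroʳ _))) (zeroˡ _)
      aₛ≈0 : ∀ k → a (suc k) ≈ 0#
      aₛ≈0 k = x*y≈0⇒x≈0 (DiffAll-lookup μs μ∉μs k)
        (main-eigenvectors-independent-modulo-Z μs-distinct ps b
          (Z-subspace (- μ) b·X′≈[M-μ]w Zw (Z-invariant Zw)) k)
      a₀≈0 : a zero ≈ 0#
      a₀≈0 = x*y≈0⇒x≈0 Σx≉0 (begin
        a zero * sum x
          ≈⟨ +-identityʳ _ ⟨
        a zero * sum x + 0#
          ≈⟨ +-congˡ (sum-0ᵛ (combination-zero (a ∘ suc) (eigenvectors ps) aₛ≈0)) ⟨
        a zero * sum x + sum (combination (a ∘ suc) (eigenvectors ps))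
          ≈⟨ sum-axpy (a zero) x _ ⟨
        sum w
          ≈⟨ Z⊥𝟙 Zw ⟩
        0# ∎)

    main-eigenvalues≤ : ∀ {r} (π : Vector Carrier n → Vector Carrier r) → IsLinear π →
      (∀ {x} → π x ≋ 0ᵛ → Z x) →
      ∀ {μs} → Distinct μs → All (IsMainEigenvalue M) μs → length μs ≤ r
    main-eigenvalues≤ π π-linear ker⊆Z μs-distinct ps =
      independent⇒≤ (π ∘ eigenvectors ps) λ a a·πX≈0 →
        main-eigenvectors-independent-modulo-Z μs-distinct ps a
          (ker⊆Z (≋-trans (IsLinear-combination π-linear a (eigenvectors ps)) a·πX≈0))

module Cotrees {c ℓ} (F : Field c ℓ) where
  open Field F hiding (zero)
  open FieldOps F using (ι; b2F; Σᶠ; Q; degree; IsMainQEigenvalue)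
  open IntegerCoefficientRingSolver commRing
  open LinearAlgebra F
  open import Algebra.Properties.Ring ring using (-0#≈0#)
  open import Algebra.Properties.Semiring.Sum semiring
    using (sum; sum-cong-≋; ∑-distrib-+; *-distribˡ-sum; *-distribʳ-sum)
  open import Data.Vec.Functional.Relation.Binary.Equality.Setoid setoid using (_≋_)
  open import Relation.Binary.Reasoning.Setoid setoid

  private
    variable
      n : ℕ

  -- `degree` counts with a function local to its where-block; `count` names
  -- that function (the unifier solves the hole from `count-degree`).
  private mutual
    count : (T : Cotree) → Fin (size T) → ∀ {n} → (Fin n → Bool) → ℕ
    count T i f = _

    count-degree : ∀ T i → count T i (adj T i) ≡.≡ degree T i
    count-degree T i with size T | adj T i
    ... | _ | _ = ≡.refl

  private
    ι-count : ∀ T i {n} (f : Fin n → Bool) → ι (count T i f) ≈ sum (b2F ∘ f)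
    ι-count T i {zero}  f = refl
    ι-count T i {suc n} f =
      trans (ι-+ (if f zero then 1 else 0) _) (+-cong (ι-if (f zero)) (ι-count T i (f ∘ suc)))
      where
      ι-if : ∀ b → ι (if b then 1 else 0) ≈ b2F b
      ι-if true  = +-identityʳ 1#
      ι-if false = refl

  ι-degree : ∀ T i → ι (degree T i) ≈ sum (λ j → b2F (adj T i j))
  ι-degree T i =
    ≡.subst (λ d → ι d ≈ sum (λ j → b2F (adj T i j))) (count-degree T i) (ι-count T i (adj T i))

  Qᴬ : (Fin n → Fin n → Bool) → Vector Carrier n → Vector Carrier n
  Qᴬ A x i = sum λ j → b2F (A i j) * (x i + x j)

  Q*ᴹ≋Qᴬ : ∀ T (x : Vector Carrier (size T)) → Q T *ᴹ x ≋ Qᴬ (adj T) x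
  Q*ᴹ≋Qᴬ T x i = begin
    sum (λ j → (δ j + A j) * x j)            ≈⟨ sum-cong-≋ (λ j → distribʳ (x j) (δ j) (A j)) ⟩
    sum (λ j → δ j * x j + A j * x j)        ≈⟨ ∑-distrib-+ (λ j → δ j * x j) (λ j → A j * x j) ⟩
    sum (λ j → δ j * x j) + sum (λ j → A j * x j)
      ≈⟨ +-congʳ (δ-sum i (ι (degree T i)) x) ⟩
    ι (degree T i) * x i + sum (λ j → A j * x j)
      ≈⟨ +-congʳ (trans (*-congʳ (ι-degree T i)) (*-distribʳ-sum (x i) A)) ⟩
    sum (λ j → A j * x i) + sum (λ j → A j * x j)
      ≈⟨ ∑-distrib-+ (λ j → A j * x i) (λ j → A j * x j) ⟨
    sum (λ j → A j * x i + A j * x j)        ≈⟨ sum-cong-≋ (λ j → distribˡ (A j) (x i) (x j)) ⟨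
    Qᴬ (adj T) x i                           ∎
    where
    δ : Fin (size T) → Carrier
    δ j = if does (i ≟ j) then ι (degree T i) else 0#
    A : Fin (size T) → Carrier
    A j = b2F (adj T i j)

  module _ (l : Label) (t : Cotree) (ts : List Cotree) where

    adjs-↑ˡ-↑ˡ : ∀ a b → adjs l (t ∷ ts) (a ↑ˡ sizes ts) (b ↑ˡ sizes ts) ≡.≡ adj t a b
    adjs-↑ˡ-↑ˡ a b rewrite splitAt-↑ˡ (size t) a (sizes ts) | splitAt-↑ˡ (size t) b (sizes ts) = ≡.refl

    adjs-↑ˡ-↑ʳ : ∀ a b → adjs l (t ∷ ts) (a ↑ˡ sizes ts) (size t ↑ʳ b) ≡.≡ isJoin l
    adjs-↑ˡ-↑ʳ a b rewrite splitAt-↑ˡ (size t) a (sizes ts) | splitAt-↑ʳ (size t) (sizes ts) b = ≡.refl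

    adjs-↑ʳ-↑ˡ : ∀ a b → adjs l (t ∷ ts) (size t ↑ʳ a) (b ↑ˡ sizes ts) ≡.≡ isJoin l
    adjs-↑ʳ-↑ˡ a b rewrite splitAt-↑ʳ (size t) (sizes ts) a | splitAt-↑ˡ (size t) b (sizes ts) = ≡.refl

    adjs-↑ʳ-↑ʳ : ∀ a b → adjs l (t ∷ ts) (size t ↑ʳ a) (size t ↑ʳ b) ≡.≡ adjs l ts a b
    adjs-↑ʳ-↑ʳ a b rewrite splitAt-↑ʳ (size t) (sizes ts) a | splitAt-↑ʳ (size t) (sizes ts) b = ≡.refl

  J : Label → Carrier
  J l = b2F (isJoin l)

  private
    sum-b2F-cong : {f g : Fin n → Bool} (v : Vector Carrier n) → (∀ j → f j ≡.≡ g j) →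
                   sum (λ j → b2F (f j) * v j) ≈ sum (λ j → b2F (g j) * v j)
    sum-b2F-cong v f≗g = sum-cong-≋ λ j → reflexive (≡.cong (λ e → b2F e * v j) (f≗g j))

    sum-join : ∀ {N} j x (r : Vector Carrier N) → sum (λ b → j * (x + r b)) ≈ j * (ι N * x + sum r)
    sum-join {N} j x r =
      trans (sym (*-distribˡ-sum j (λ b → x + r b)))
            (*-congˡ (trans (∑-distrib-+ (λ _ → x) r) (+-congʳ (sum-const N x))))

  Qᴬ-↑ˡ : ∀ l t ts (z : Vector Carrier (sizes (t ∷ ts))) a →
    Qᴬ (adjs l (t ∷ ts)) z (a ↑ˡ sizes ts) ≈
    Qᴬ (adj t) (take (size t) z) a + J l * (ι (sizes ts) * z (a ↑ˡ sizes ts) + sum (drop (size t) z))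
  Qᴬ-↑ˡ l t ts z a = trans (sum-split (size t) _) (+-cong
    (sum-b2F-cong (λ b → z (a ↑ˡ sizes ts) + z (b ↑ˡ sizes ts)) (adjs-↑ˡ-↑ˡ l t ts a))
    (trans (sum-b2F-cong (λ b → z (a ↑ˡ sizes ts) + z (size t ↑ʳ b)) (adjs-↑ˡ-↑ʳ l t ts a))
           (sum-join (J l) _ (drop (size t) z))))

  Qᴬ-↑ʳ : ∀ l t ts (z : Vector Carrier (sizes (t ∷ ts))) b →
    Qᴬ (adjs l (t ∷ ts)) z (size t ↑ʳ b) ≈
    Qᴬ (adjs l ts) (drop (size t) z) b + J l * (ι (size t) * z (size t ↑ʳ b) + sum (take (size t) z))
  Qᴬ-↑ʳ l t ts z b = trans (sum-split (size t) _) (trans (+-comm _ _) (+-cong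
    (sum-b2F-cong (λ a → z (size t ↑ʳ b) + z (size t ↑ʳ a)) (adjs-↑ʳ-↑ʳ l t ts b))
    (trans (sum-b2F-cong (λ a → z (size t ↑ʳ b) + z (a ↑ˡ sizes ts)) (adjs-↑ʳ-↑ˡ l t ts b))
           (sum-join (J l) _ (take (size t) z)))))

  leafPart : (t : Cotree) → Vector Carrier (size t) → Carrier
  leafPart leaf       z = z zero
  leafPart (node _ _) _ = 0#

  bagSum : (ts : List Cotree) → Vector Carrier (sizes ts) → Carrier
  bagSum []       _ = 0#
  bagSum (t ∷ ts) z = leafPart t (take (size t) z) + bagSum ts (drop (size t) z)

  mutual
    Balanced : (t : Cotree) → Vector Carrier (size t) → Set ℓ
    Balanced leaf        _ = Lift ℓ ⊤
    Balanced (node _ ts) z = bagSum ts z ≈ 0# × BalancedChildren ts z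

    BalancedChildren : (ts : List Cotree) → Vector Carrier (sizes ts) → Set ℓ
    BalancedChildren []       _ = Lift ℓ ⊤
    BalancedChildren (t ∷ ts) z = Balanced t (take (size t) z) × BalancedChildren ts (drop (size t) z)

  bagSum-linear : ∀ ts a {x y w} → w ≋ a ·ᵛ x +ᵛ y → bagSum ts w ≈ a * bagSum ts x + bagSum ts y
  bagSum-linear []       a _  = sym (trans (+-congʳ (zeroʳ a)) (+-identityˡ 0#))
  bagSum-linear (t ∷ ts) a w≋ = trans
    (+-cong (leafPart-linear t (w≋ ∘ (_↑ˡ sizes ts))) (bagSum-linear ts a (w≋ ∘ (size t ↑ʳ_))))
    (solve 5 (λ a p q r s → (a :* p :+ q) :+ (a :* r :+ s) := a :* (p :+ r) :+ (q :+ s)) refl a _ _ _ _)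
    where
    leafPart-linear : ∀ t {x y w} → w ≋ a ·ᵛ x +ᵛ y → leafPart t w ≈ a * leafPart t x + leafPart t y
    leafPart-linear leaf       w≋ = w≋ zero
    leafPart-linear (node _ _) _  = sym (trans (+-congʳ (zeroʳ a)) (+-identityˡ 0#))

  bagSum-cong : ∀ ts {w y} → w ≋ y → bagSum ts w ≈ bagSum ts y
  bagSum-cong ts w≋y = trans (bagSum-linear ts 0# (≋⇒≋0·+ w≋y)) (trans (+-congʳ (zeroˡ _)) (+-identityˡ _))

  mutual
    Balanced-subspace : ∀ t → IsSubspace (Balanced t)
    Balanced-subspace leaf        _ _  _              _              = lift tt
    Balanced-subspace (node _ ts) a w≋ (Σx≈0 , x-bal) (Σy≈0 , y-bal) =
      trans (bagSum-linear ts a w≋) (trans (+-cong (trans (*-congˡ Σx≈0) (zeroʳ a)) Σy≈0) (+-identityˡ 0#)) ,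
      BalancedChildren-subspace ts a w≋ x-bal y-bal

    BalancedChildren-subspace : ∀ ts → IsSubspace (BalancedChildren ts)
    BalancedChildren-subspace []       _ _  _               _               = lift tt
    BalancedChildren-subspace (t ∷ ts) a w≋ (xₜ-bal , xs-bal) (yₜ-bal , ys-bal) =
      Balanced-subspace t a (w≋ ∘ (_↑ˡ sizes ts)) xₜ-bal yₜ-bal ,
      BalancedChildren-subspace ts a (w≋ ∘ (size t ↑ʳ_)) xs-bal ys-bal

  mutual
    sum-Balanced : ∀ t {z} → Balanced t z → sum z ≈ leafPart t z
    sum-Balanced leaf        _              = +-identityʳ _
    sum-Balanced (node _ ts) (Σz≈0 , z-bal) = trans (sum-BalancedChildren ts z-bal) Σz≈0

    sum-BalancedChildren : ∀ ts {z} → BalancedChildren ts z → sum z ≈ bagSum ts z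
    sum-BalancedChildren []       _               = refl
    sum-BalancedChildren (t ∷ ts) {z} (zₜ-bal , zs-bal) =
      trans (sum-split (size t) z) (+-cong (sum-Balanced t zₜ-bal) (sum-BalancedChildren ts zs-bal))

  -- If ts are the last children of a node labelled l and the earlier ones have
  -- α vertices in total, with entries summing to -(sum z), then Qᶜ l ts α z is
  -- Qᴬ of the node restricted to the vertices below ts.
  Qᶜ : Label → (ts : List Cotree) → Carrier → Vector Carrier (sizes ts) → Vector Carrier (sizes ts)
  Qᶜ l ts α z i = Qᴬ (adjs l ts) z i + J l * (α * z i - sum z)

  Qᶜ-↑ˡ : ∀ l t ts α (z : Vector Carrier (sizes (t ∷ ts))) a →
    Qᶜ l (t ∷ ts) α z (a ↑ˡ sizes ts) ≈
    Qᴬ (adj t) (take (size t) z) a + J l * ((ι (sizes ts) + α) * take (size t) z a - sum (take (size t) z))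
  Qᶜ-↑ˡ l t ts α z a = begin
    Qᴬ (adjs l (t ∷ ts)) z (a ↑ˡ sizes ts) + J l * (α * zₐ - sum z)
      ≈⟨ +-cong (Qᴬ-↑ˡ l t ts z a) (*-congˡ (+-congˡ (-‿cong (sum-split (size t) z)))) ⟩
    q + J l * (ι (sizes ts) * zₐ + Σᵣ) + J l * (α * zₐ - (Σₗ + Σᵣ))
      ≈⟨ solve 7 (λ q j n x sₗ sᵣ α → q :+ j :* (n :* x :+ sᵣ) :+ j :* (α :* x :- (sₗ :+ sᵣ))
                                     := q :+ j :* ((n :+ α) :* x :- sₗ))
                 refl q (J l) (ι (sizes ts)) zₐ Σₗ Σᵣ α ⟩
    q + J l * ((ι (sizes ts) + α) * zₐ - Σₗ) ∎
    where
    q = Qᴬ (adj t) (take (size t) z) a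
    zₐ = z (a ↑ˡ sizes ts)
    Σₗ = sum (take (size t) z)
    Σᵣ = sum (drop (size t) z)

  Qᶜ-drop : ∀ l t ts α (z : Vector Carrier (sizes (t ∷ ts))) →
    drop (size t) (Qᶜ l (t ∷ ts) α z) ≋ Qᶜ l ts (α + ι (size t)) (drop (size t) z)
  Qᶜ-drop l t ts α z b = begin
    Qᴬ (adjs l (t ∷ ts)) z (size t ↑ʳ b) + J l * (α * z_b - sum z)
      ≈⟨ +-cong (Qᴬ-↑ʳ l t ts z b) (*-congˡ (+-congˡ (-‿cong (sum-split (size t) z)))) ⟩
    q + J l * (ι (size t) * z_b + Σₗ) + J l * (α * z_b - (Σₗ + Σᵣ))
      ≈⟨ solve 7 (λ q j m x sₗ sᵣ α → q :+ j :* (m :* x :+ sₗ) :+ j :* (α :* x :- (sₗ :+ sᵣ))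
                                     := q :+ j :* ((α :+ m) :* x :- sᵣ))
                 refl q (J l) (ι (size t)) z_b Σₗ Σᵣ α ⟩
    q + J l * ((α + ι (size t)) * z_b - Σᵣ) ∎
    where
    q = Qᴬ (adjs l ts) (drop (size t) z) b
    z_b = z (size t ↑ʳ b)
    Σₗ = sum (take (size t) z)
    Σᵣ = sum (drop (size t) z)

  BalancedChildren-cong : ∀ ts {w y} → w ≋ y → BalancedChildren ts y → BalancedChildren ts w
  BalancedChildren-cong ts = IsSubspace⇒cong (BalancedChildren-subspace ts)

  -- A leaf child u of a join node with N vertices whose entries sum to zero
  -- has (Qᴬ z)_u = (N - 1) z_u - z_u; here N = sizes ts + α.
  bagSum-Qᶜ : ∀ l ts α {z} → BalancedChildren ts z →
    bagSum ts (Qᶜ l ts α z) ≈ J l * ((ι (sizes ts) + α - (1# + 1#)) * bagSum ts z)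
  bagSum-Qᶜ l [] α _ = sym (trans (*-congˡ (zeroʳ _)) (zeroʳ _))
  bagSum-Qᶜ l (leaf ∷ ts) α {z} (_ , zs-bal) = begin
    Qᶜ l (leaf ∷ ts) α z (zero ↑ˡ sizes ts) + bagSum ts (drop 1 (Qᶜ l (leaf ∷ ts) α z))
      ≈⟨ +-cong leaf-entry
                (trans (bagSum-cong ts (Qᶜ-drop l leaf ts α z)) (bagSum-Qᶜ l ts (α + ι 1) zs-bal)) ⟩
    J l * ((N + α - 1#) * z₀) + J l * ((N + (α + ι 1) - (1# + 1#)) * L)
      ≈⟨ +-congˡ (*-congˡ (*-congʳ (+-congʳ (+-congˡ (+-congˡ (+-identityʳ 1#)))))) ⟩
    J l * ((N + α - 1#) * z₀) + J l * ((N + (α + 1#) - (1# + 1#)) * L)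
      ≈⟨ solve 6 (λ j N α z L u → j :* ((N :+ α :- u) :* z) :+ j :* ((N :+ (α :+ u) :- (u :+ u)) :* L)
                                 := j :* ((u :+ N :+ α :- (u :+ u)) :* (z :+ L)))
                 refl (J l) N α z₀ L 1# ⟩
    J l * ((1# + N + α - (1# + 1#)) * (z₀ + L)) ∎
    where
    N = ι (sizes ts)
    z₀ = z (zero ↑ˡ sizes ts)
    L = bagSum ts (drop 1 z)
    leaf-entry : Qᶜ l (leaf ∷ ts) α z (zero ↑ˡ sizes ts) ≈ J l * ((N + α - 1#) * z₀)
    leaf-entry = begin
      Qᶜ l (leaf ∷ ts) α z (zero ↑ˡ sizes ts)
        ≈⟨ Qᶜ-↑ˡ l leaf ts α z zero ⟩
      (0# * (z₀ + z₀) + 0#) + J l * ((N + α) * z₀ - (z₀ + 0#))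
        ≈⟨ +-cong (trans (+-congʳ (zeroˡ _)) (+-identityˡ 0#))
                  (*-congˡ (+-congˡ (-‿cong (+-identityʳ z₀)))) ⟩
      0# + J l * ((N + α) * z₀ - z₀)
        ≈⟨ trans (+-identityˡ _) (*-congˡ (+-congˡ (-‿cong (sym (*-identityˡ z₀))))) ⟩
      J l * ((N + α) * z₀ - 1# * z₀)
        ≈⟨ *-congˡ (solve 4 (λ N α z u → (N :+ α) :* z :- u :* z := (N :+ α :- u) :* z)
                            refl N α z₀ 1#) ⟩
      J l * ((N + α - 1#) * z₀) ∎
  bagSum-Qᶜ l (node l′ ts′ ∷ ts) α {z} (_ , zs-bal) = begin
    0# + bagSum ts (drop m (Qᶜ l (node l′ ts′ ∷ ts) α z))
      ≈⟨ trans (+-identityˡ _) (bagSum-cong ts (Qᶜ-drop l (node l′ ts′) ts α z)) ⟩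
    bagSum ts (Qᶜ l ts (α + ι m) (drop m z))
      ≈⟨ bagSum-Qᶜ l ts (α + ι m) zs-bal ⟩
    J l * ((N + (α + ι m) - (1# + 1#)) * L)
      ≈⟨ solve 6 (λ j N α M u L → j :* ((N :+ (α :+ M) :- (u :+ u)) :* L)
                                 := j :* ((M :+ N :+ α :- (u :+ u)) :* L))
                 refl (J l) N α (ι m) 1# L ⟩
    J l * ((ι m + N + α - (1# + 1#)) * L)
      ≈⟨ *-congˡ (*-cong (+-congʳ (+-congʳ (ι-+ m (sizes ts)))) (+-identityˡ L)) ⟨
    J l * ((ι (m ℕ.+ sizes ts) + α - (1# + 1#)) * (0# + L)) ∎
    where
    m = sizes ts′
    N = ι (sizes ts)
    L = bagSum ts (drop m z)

  mutual
    Qᶜ-BalancedChildren : ∀ l ts α {z} → BalancedChildren ts z → BalancedChildren ts (Qᶜ l ts α z)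
    Qᶜ-BalancedChildren l []       α _ = lift tt
    Qᶜ-BalancedChildren l (t ∷ ts) α {z} (zₜ-bal , zs-bal) =
      Qᶜ-take-Balanced l t ts α zₜ-bal ,
      BalancedChildren-cong ts (Qᶜ-drop l t ts α z) (Qᶜ-BalancedChildren l ts (α + ι (size t)) zs-bal)

    Qᶜ-take-Balanced : ∀ l t ts α {z} → Balanced t (take (size t) z) →
                       Balanced t (take (size t) (Qᶜ l (t ∷ ts) α z))
    Qᶜ-take-Balanced l leaf          ts α _ = lift tt
    Qᶜ-take-Balanced l (node l′ ts′) ts α {z} zₜ-bal =
      Balanced-subspace (node l′ ts′) (J l * (N + α)) entries zₜ-bal (Qᴬ-Balanced l′ ts′ zₜ-bal)
      where
      N = ι (sizes ts)
      zₜ = take (sizes ts′) z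
      entries : take (sizes ts′) (Qᶜ l (node l′ ts′ ∷ ts) α z) ≋
                J l * (N + α) ·ᵛ zₜ +ᵛ Qᴬ (adjs l′ ts′) zₜ
      entries a = begin
        Qᶜ l (node l′ ts′ ∷ ts) α z (a ↑ˡ sizes ts)
          ≈⟨ Qᶜ-↑ˡ l (node l′ ts′) ts α z a ⟩
        q + J l * ((N + α) * zₜ a - sum zₜ)
          ≈⟨ +-congˡ (*-congˡ (+-congˡ (trans (-‿cong (sum-Balanced (node l′ ts′) zₜ-bal)) -0#≈0#))) ⟩
        q + J l * ((N + α) * zₜ a + 0#)
          ≈⟨ +-congˡ (*-congˡ (+-identityʳ _)) ⟩
        q + J l * ((N + α) * zₜ a)
          ≈⟨ solve 4 (λ q j m x → q :+ j :* (m :* x) := j :* m :* x :+ q) refl q (J l) (N + α) (zₜ a) ⟩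
        J l * (N + α) * zₜ a + q ∎
        where q = Qᴬ (adjs l′ ts′) zₜ a

    Qᴬ-Balanced : ∀ l ts {z} → Balanced (node l ts) z → Balanced (node l ts) (Qᴬ (adjs l ts) z)
    Qᴬ-Balanced l ts {z} z-bal@(bagSum≈0 , zs-bal) =
      trans (bagSum-cong ts Qᴬ≋Qᶜ)
            (trans (bagSum-Qᶜ l ts 0# zs-bal) (trans (*-congˡ (trans (*-congˡ bagSum≈0) (zeroʳ _))) (zeroʳ _))) ,
      BalancedChildren-cong ts Qᴬ≋Qᶜ (Qᶜ-BalancedChildren l ts 0# zs-bal)
      where
      Qᴬ≋Qᶜ : Qᴬ (adjs l ts) z ≋ Qᶜ l ts 0# z
      Qᴬ≋Qᶜ i = sym (trans (+-congˡ context≈0) (+-identityʳ _))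
        where
        context≈0 : J l * (0# * z i - sum z) ≈ 0#
        context≈0 = trans
          (*-congˡ (trans (+-cong (zeroˡ _) (-‿cong (sum-Balanced (node l ts) z-bal))) (-‿inverseʳ 0#)))
          (zeroʳ _)

  Balanced-Q-invariant : ∀ l ts {x} → Balanced (node l ts) x → Balanced (node l ts) (Q (node l ts) *ᴹ x)
  Balanced-Q-invariant l ts x-bal =
    IsSubspace⇒cong (Balanced-subspace (node l ts)) (Q*ᴹ≋Qᴬ (node l ts) _) (Qᴬ-Balanced l ts x-bal)

  mutual
    bagSums : (t : Cotree) → Vector Carrier (size t) → Vector Carrier (width t)
    bagSums leaf        _ = Vector.[]
    bagSums (node _ ts) z with anyLeaf ts
    ... | true  = bagSum ts z Vector.∷ childBagSums ts z
    ... | false = childBagSums ts z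

    childBagSums : (ts : List Cotree) → Vector Carrier (sizes ts) → Vector Carrier (widths ts)
    childBagSums []       _ = Vector.[]
    childBagSums (t ∷ ts) z = bagSums t (take (size t) z) Vector.++ childBagSums ts (drop (size t) z)

  mutual
    bagSums-linear : ∀ t → IsLinear (bagSums t)
    bagSums-linear leaf        _ _  ()
    bagSums-linear (node _ ts) a w≋ with anyLeaf ts
    ... | true  = λ { zero → bagSum-linear ts a w≋ ; (suc j) → childBagSums-linear ts a w≋ j }
    ... | false = childBagSums-linear ts a w≋

    childBagSums-linear : ∀ ts → IsLinear (childBagSums ts)
    childBagSums-linear []       _ _  ()
    childBagSums-linear (t ∷ ts) a w≋ j with splitAt (width t) j
    ... | inj₁ i = bagSums-linear t a (w≋ ∘ (_↑ˡ sizes ts)) i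
    ... | inj₂ i = childBagSums-linear ts a (w≋ ∘ (size t ↑ʳ_)) i

  bagSum-noLeaf : ∀ ts {z} → anyLeaf ts ≡.≡ false → bagSum ts z ≈ 0#
  bagSum-noLeaf []              _  = refl
  bagSum-noLeaf (node _ _ ∷ ts) eq = trans (+-identityˡ _) (bagSum-noLeaf ts eq)

  mutual
    bagSums-kernel : ∀ t {z} → bagSums t z ≋ 0ᵛ → Balanced t z
    bagSums-kernel leaf        _ = lift tt
    bagSums-kernel (node _ ts) with anyLeaf ts in noLeaf
    ... | true  = λ z∈ker → z∈ker zero , childBagSums-kernel ts (z∈ker ∘ suc)
    ... | false = λ z∈ker → bagSum-noLeaf ts noLeaf , childBagSums-kernel ts z∈ker

    childBagSums-kernel : ∀ ts {z} → childBagSums ts z ≋ 0ᵛ → BalancedChildren ts z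
    childBagSums-kernel []       _     = lift tt
    childBagSums-kernel (t ∷ ts) {z} z∈ker =
      bagSums-kernel t (λ i → trans (reflexive (≡.sym (lookup-++ˡ zₜ zs i))) (z∈ker (i ↑ˡ widths ts))) ,
      childBagSums-kernel ts (λ i → trans (reflexive (≡.sym (lookup-++ʳ zₜ zs i))) (z∈ker (width t ↑ʳ i)))
      where
      zₜ = bagSums t (take (size t) z)
      zs = childBagSums ts (drop (size t) z)

  IsMainQEigenvalue⇒IsMainEigenvalue : ∀ T {μ} → IsMainQEigenvalue T μ → IsMainEigenvalue (Q T) μ
  IsMainQEigenvalue⇒IsMainEigenvalue T (x , Qx≈μx , Σx≉0) =
    x ,
    (λ i → trans (reflexive (≡.sym (Σᶠ≡sum (λ j → Q T i j * x j)))) (Qx≈μx i)) ,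
    (λ Σx≈0 → Σx≉0 (trans (reflexive (Σᶠ≡sum x)) Σx≈0))

theorem2 : ∀ {c ℓ} (F : Field c ℓ) → FieldOps.CharZero F →
    (l : Label) (ts : List Cotree) → Normalized (node l ts) →
    (μs : List (Field.Carrier F)) → FieldOps.Distinct F μs →
    All (FieldOps.IsMainQEigenvalue F (node l ts)) μs →
    length μs ≤ width (node l ts)
theorem2 F _ l ts _ μs μs-distinct μs-main =
  main-eigenvalues≤ (bagSums T) (bagSums-linear T) (bagSums-kernel T) μs-distinct
    (All.map (IsMainQEigenvalue⇒IsMainEigenvalue T) μs-main)
  where
  open LinearAlgebra F
  open Cotrees F
  T : Cotree
  T = node l ts
  open InvariantSubspace (FieldOps.Q F T) (Balanced T)
    (Balanced-subspace T) (Balanced-Q-invariant l ts) (sum-Balanced T)
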